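{- (a) For every $n\ge 1$ there exists a self-complementary graph on $4n$ vertices which does not contain a $K_{2n+1}$ minor. (b) For every $n\ge 0$ there exists a self-complementary graph on $4n+1$ vertices which does not contain a $K_{2n+2}$ minor.
   Context: Graphs are finite, simple and undirected. $cG$ denotes the complement of $G$ (same vertex set, two distinct vertices adjacent in $cG$ iff not adjacent in $G$); $G$ is self-complementary if $G\cong cG$. A minor is obtained by edge deletions, vertex deletions and edge contractions. -}

module Defs where

open import Data.Nat using (ℕ; suc)
open import Data.Fin using (Fin; punchIn)
open import Data.Product using (Σ; _×_; _,_; proj₁; proj₂)
open import Data.Sum using (_⊎_; inj₁; inj₂)
open import Relation.Nullary using (¬_)
open import Relation.Binary.PropositionalEquality using (_≡_; _≢_; refl; sym)
open import Relation.Binary.Construct.Closure.ReflexiveTransitive using (Star)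
open import Function.Bundles using (_↔_; Inverse; _⇔_)

record Graph (n : ℕ) : Set₁ where
  field
    Adj    : Fin n → Fin n → Set
    adj-sym    : ∀ {x y} → Adj x y → Adj y x
    adj-irrefl : ∀ {x} → ¬ Adj x x
open Graph public

complement : ∀ {n} → Graph n → Graph n
complement G = record
  { Adj    = λ x y → x ≢ y × ¬ Adj G x y
  ; adj-sym    = λ { (x≢y , ¬a) → (λ e → x≢y (sym e)) , (λ a → ¬a (adj-sym G a)) }
  ; adj-irrefl = λ { (x≢x , _) → x≢x refl }
  }

K : (m : ℕ) → Graph m
K m = record
  { Adj    = λ x y → x ≢ y
  ; adj-sym    = λ x≢y e → x≢y (sym e)
  ; adj-irrefl = λ x≢x → x≢x refl
  }

record _≅_ {n m : ℕ} (G : Graph n) (H : Graph m) : Set where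
  field
    bij : Fin n ↔ Fin m
    adj : ∀ x y → Adj G x y ⇔ Adj H (Inverse.to bij x) (Inverse.to bij y)

SelfComplementary : ∀ {n} → Graph n → Set
SelfComplementary G = G ≅ complement G

deleteEdge : ∀ {n} → Graph n → Fin n → Fin n → Graph n
deleteEdge G u v = record
  { Adj    = λ x y → Adj G x y × ¬ ((x ≡ u × y ≡ v) ⊎ (x ≡ v × y ≡ u))
  ; adj-sym    = λ { (a , ne) → adj-sym G a
                 , (λ { (inj₁ (p , q)) → ne (inj₂ (q , p))
                      ; (inj₂ (p , q)) → ne (inj₁ (q , p)) }) }
  ; adj-irrefl = λ { (a , _) → adj-irrefl G a }
  }

deleteVertex : ∀ {n} → Graph (suc n) → Fin (suc n) → Graph n
deleteVertex G v = record
  { Adj    = λ x y → Adj G (punchIn v x) (punchIn v y)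
  ; adj-sym    = adj-sym G
  ; adj-irrefl = adj-irrefl G
  }

-- Contracting the edge {u , v} (u adjacent to v): v is merged into u.
contractAdj : ∀ {n} → Graph (suc n) → (u v : Fin (suc n)) → Fin n → Fin n → Set
contractAdj G u v x y =
  x ≢ y × ( Adj G (punchIn v x) (punchIn v y)
          ⊎ (punchIn v x ≡ u × Adj G v (punchIn v y))
          ⊎ (punchIn v y ≡ u × Adj G (punchIn v x) v))

contractEdge : ∀ {n} → Graph (suc n) → (u v : Fin (suc n)) → Graph n
contractEdge G u v = record
  { Adj    = contractAdj G u v
  ; adj-sym    = λ { (x≢y , inj₁ a) → (λ e → x≢y (sym e)) , inj₁ (adj-sym G a)
               ; (x≢y , inj₂ (inj₁ (p , a))) → (λ e → x≢y (sym e)) , inj₂ (inj₂ (p , adj-sym G a))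
               ; (x≢y , inj₂ (inj₂ (p , a))) → (λ e → x≢y (sym e)) , inj₂ (inj₁ (p , adj-sym G a)) }
  ; adj-irrefl = λ { (x≢x , _) → x≢x refl }
  }

AnyGraph : Set₁
AnyGraph = Σ ℕ Graph

data _⟶_ : AnyGraph → AnyGraph → Set₁ where
  delE : ∀ {n} (G : Graph n) (u v : Fin n) → (n , G) ⟶ (n , deleteEdge G u v)
  delV : ∀ {n} (G : Graph (suc n)) (v : Fin (suc n)) → (suc n , G) ⟶ (n , deleteVertex G v)
  con  : ∀ {n} (G : Graph (suc n)) (u v : Fin (suc n)) → u ≢ v → Adj G u v →
         (suc n , G) ⟶ (n , contractEdge G u v)

_IsMinorOf_ : ∀ {m n} → Graph m → Graph n → Set₁
_IsMinorOf_ {m} {n} H G =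
  Σ AnyGraph λ G' → Star _⟶_ (n , G) G' × (proj₂ G' ≅ H)

HasCliqueMinor : ∀ {n} → ℕ → Graph n → Set₁
HasCliqueMinor m G = K m IsMinorOf G

-- Blow up the path b₀ – b₁ – b₂ – b₃: b₀ and b₃ become independent sets and b₁, b₂ cliques of
-- n vertices, consecutive blocks are completely joined, and for 4n + 1 vertices a centre is
-- joined to b₁ ∪ b₂.  The rotation b₀ ↦ b₁ ↦ b₃ ↦ b₂ ↦ b₀ of the blocks maps this graph onto
-- its complement.  The vertices of b₁, b₂ and the centre (2n or 2n + 1 of them) form a vertex
-- cover whose other vertices have degree n.  Having a vertex cover of at most s vertices outside of which all
-- degrees are at most d survives edge and vertex deletion and edge contraction (an edge has an
-- end in the cover, so the merged vertex lies in it), but K_{s+1} has no such cover when d < s: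
-- an uncovered vertex would have degree s, and otherwise all s + 1 vertices would be covered.
module Submission where

open import Defs
open import Data.Bool using (Bool; true; false; not; T; _∨_)
open import Data.Bool.Properties using (∨-comm) renaming (_≟_ to _≟ᵇ_)
open import Data.Empty using (⊥-elim)
open import Data.Fin using (Fin; zero; suc; punchIn)
open import Data.Fin.Properties
  using (_≟_; any?; all?; injective⇒≤; punchIn-injective; punchInᵢ≢i; +↔⊎; *↔×)
open import Data.Maybe using (Maybe; just; nothing; _<∣>_)
import Data.Maybe.Properties as Maybe
open import Data.Nat using (ℕ; suc; _+_; _*_; _≤_; _<_)
open import Data.Nat.Properties
  using (1+n≰n; <⇒≱; m≤m+n; m≤n+m; m<m+n; +-identityʳ; +-assoc; +-comm; +-suc; ≤-trans)
open import Data.Product using (Σ; ∃; _×_; _,_; proj₁; proj₂)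
open import Data.Product.Function.NonDependent.Propositional using (_×-↔_)
open import Data.Sum using (_⊎_; inj₁; inj₂)
open import Data.Sum.Function.Propositional using (_⊎-↔_)
open import Function using (_∘_)
open import Function.Bundles using (_↔_; Inverse; Injection; Equivalence; mk⇔; mk↔ₛ′)
open import Function.Properties.Inverse using (↔-refl; ↔-sym; ↔-trans; ↔⇒↣)
open import Relation.Binary.Construct.Closure.ReflexiveTransitive using (Star; ε; _◅_)
open import Relation.Binary.PropositionalEquality
  using (_≡_; _≢_; refl; sym; trans; cong; cong₂; subst; subst₂; ≢-sym; module ≡-Reasoning)
open import Relation.Nullary using (¬_; yes; no; Irrelevant)
open import Relation.Nullary.Decidable using (from-yes; _×-dec_; _⊎-dec_)

record DegreeAtMost {N : ℕ} (d : ℕ) (G : Graph N) (w : Fin N) : Set where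
  field
    slot           : ∀ x → Adj G w x → Fin d
    slot-injective : ∀ x y a b → slot x a ≡ slot y b → x ≡ y
open DegreeAtMost

-- The indexed vertices (at most s of them) form a vertex cover; the others have degree at most d.
record BoundedCover {N : ℕ} (s d : ℕ) (G : Graph N) : Set where
  field
    index           : Fin N → Maybe (Fin s)
    index-injective : ∀ {x y i} → index x ≡ just i → index y ≡ just i → x ≡ y
    independent     : ∀ {x y} → index x ≡ nothing → index y ≡ nothing → ¬ Adj G x y
    degree          : ∀ {w} → index w ≡ nothing → DegreeAtMost d G w
open BoundedCover

DegreeAtMost-embed : ∀ {m n d} {G : Graph m} {H : Graph n} {w w′} →
                     (g : ∀ x → Adj H w′ x → Σ (Fin m) (Adj G w)) →
                     (∀ x y a b → proj₁ (g x a) ≡ proj₁ (g y b) → x ≡ y) →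
                     DegreeAtMost d G w → DegreeAtMost d H w′
DegreeAtMost-embed g g-injective D = record
  { slot           = λ x a → slot D (proj₁ (g x a)) (proj₂ (g x a))
  ; slot-injective = λ x y a b → g-injective x y a b ∘ slot-injective D _ _ _ _
  }

BoundedCover-subgraph : ∀ {m n s d} {G : Graph m} {H : Graph n} (h : Fin n → Fin m) →
                        (∀ {x y} → h x ≡ h y → x ≡ y) →
                        (∀ {x y} → Adj H x y → Adj G (h x) (h y)) →
                        BoundedCover s d G → BoundedCover s d H
BoundedCover-subgraph h h-injective h-adj C = record
  { index           = index C ∘ h
  ; index-injective = λ hx hy → h-injective (index-injective C hx hy)
  ; independent     = λ hx hy → independent C hx hy ∘ h-adj
  ; degree          = λ hw → DegreeAtMost-embed (λ x a → h x , h-adj a) (λ _ _ _ _ → h-injective) (degree C hw)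
  }

<∣>-just : ∀ {A : Set} (a b : Maybe A) {i} → (a <∣> b) ≡ just i → a ≡ just i ⊎ b ≡ just i
<∣>-just (just _) _ e = inj₁ e
<∣>-just nothing  _ e = inj₂ e

<∣>-nothing : ∀ {A : Set} (a b : Maybe A) → (a <∣> b) ≡ nothing → a ≡ nothing × b ≡ nothing
<∣>-nothing nothing _ e = refl , e

module Contraction {n s d} {G : Graph (suc n)} {u v : Fin (suc n)} (uv : Adj G u v)
                   (C : BoundedCover s d G) where

  merged : Maybe (Fin s)
  merged = index C u <∣> index C v

  merged-covered : merged ≢ nothing
  merged-covered e with <∣>-nothing (index C u) (index C v) e
  ... | u-out , v-out = independent C u-out v-out uv

  merged-unique : ∀ {y i} → merged ≡ just i → index C y ≡ just i → y ≡ u ⊎ y ≡ v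
  merged-unique m≡i y≡i with <∣>-just (index C u) (index C v) m≡i
  ... | inj₁ u≡i = inj₁ (index-injective C y≡i u≡i)
  ... | inj₂ v≡i = inj₂ (index-injective C y≡i v≡i)

  index′ : Fin n → Maybe (Fin s)
  index′ x with punchIn v x ≟ u
  ... | yes _ = merged
  ... | no  _ = index C (punchIn v x)

  index′-cases : ∀ x → (punchIn v x ≡ u × index′ x ≡ merged)
                     ⊎ (punchIn v x ≢ u × index′ x ≡ index C (punchIn v x))
  index′-cases x with punchIn v x ≟ u
  ... | yes x≡u = inj₁ (x≡u , refl)
  ... | no  x≢u = inj₂ (x≢u , refl)

  merged-only-at-u : ∀ y → punchIn v y ≢ u → ∀ {i} → merged ≡ just i → index C (punchIn v y) ≢ just i
  merged-only-at-u y y≢u m≡i y≡i with merged-unique m≡i y≡i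
  ... | inj₁ y≡u = y≢u y≡u
  ... | inj₂ y≡v = punchInᵢ≢i v y y≡v

  index′-injective : ∀ {x y i} → index′ x ≡ just i → index′ y ≡ just i → x ≡ y
  index′-injective {x} {y} x≡i y≡i with index′-cases x | index′-cases y
  ... | inj₁ (x≡u , _) | inj₁ (y≡u , _) = punchIn-injective v x y (trans x≡u (sym y≡u))
  ... | inj₂ (_ , ex) | inj₂ (_ , ey) =
    punchIn-injective v x y (index-injective C (trans (sym ex) x≡i) (trans (sym ey) y≡i))
  ... | inj₁ (_ , ex) | inj₂ (y≢u , ey) =
    ⊥-elim (merged-only-at-u y y≢u (trans (sym ex) x≡i) (trans (sym ey) y≡i))
  ... | inj₂ (x≢u , ex) | inj₁ (_ , ey) =
    ⊥-elim (merged-only-at-u x x≢u (trans (sym ey) y≡i) (trans (sym ex) x≡i))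

  index′-independent : ∀ {x y} → index′ x ≡ nothing → index′ y ≡ nothing → ¬ contractAdj G u v x y
  index′-independent {x} {y} x-out y-out (_ , xy) with index′-cases x | index′-cases y
  ... | inj₁ (_ , ex) | _ = merged-covered (trans (sym ex) x-out)
  ... | inj₂ _ | inj₁ (_ , ey) = merged-covered (trans (sym ey) y-out)
  ... | inj₂ (x≢u , ex) | inj₂ (y≢u , ey) with xy
  ...   | inj₁ a                = independent C (trans (sym ex) x-out) (trans (sym ey) y-out) a
  ...   | inj₂ (inj₁ (x≡u , _)) = x≢u x≡u
  ...   | inj₂ (inj₂ (y≡u , _)) = y≢u y≡u

  -- An edge of the contraction at a vertex w ≠ u comes from an edge of G at w, to x or to v.
  uncontract : ∀ {w} → punchIn v w ≢ u → ∀ x → contractAdj G u v w x → Σ (Fin (suc n)) (Adj G (punchIn v w))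
  uncontract _   x (_ , inj₁ a)                = punchIn v x , a
  uncontract w≢u _ (_ , inj₂ (inj₁ (w≡u , _))) = ⊥-elim (w≢u w≡u)
  uncontract _   _ (_ , inj₂ (inj₂ (_ , a)))   = v , a

  uncontract-injective : ∀ {w} (w≢u : punchIn v w ≢ u) x y a b →
                         proj₁ (uncontract w≢u x a) ≡ proj₁ (uncontract w≢u y b) → x ≡ y
  uncontract-injective w≢u x y (_ , inj₂ (inj₁ (w≡u , _))) _ _ = ⊥-elim (w≢u w≡u)
  uncontract-injective w≢u x y _ (_ , inj₂ (inj₁ (w≡u , _))) _ = ⊥-elim (w≢u w≡u)
  uncontract-injective _ x y (_ , inj₁ _) (_ , inj₁ _) e = punchIn-injective v x y e
  uncontract-injective _ x y (_ , inj₁ _) (_ , inj₂ (inj₂ _)) e = ⊥-elim (punchInᵢ≢i v x e)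
  uncontract-injective _ x y (_ , inj₂ (inj₂ _)) (_ , inj₁ _) e = ⊥-elim (punchInᵢ≢i v y (sym e))
  uncontract-injective _ x y (_ , inj₂ (inj₂ (x≡u , _))) (_ , inj₂ (inj₂ (y≡u , _))) _ =
    punchIn-injective v x y (trans x≡u (sym y≡u))

  index′-degree : ∀ {w} → index′ w ≡ nothing → DegreeAtMost d (contractEdge G u v) w
  index′-degree {w} w-out with index′-cases w
  ... | inj₁ (_ , ew) = ⊥-elim (merged-covered (trans (sym ew) w-out))
  ... | inj₂ (w≢u , ew) =
    DegreeAtMost-embed (uncontract w≢u) (uncontract-injective w≢u) (degree C (trans (sym ew) w-out))

  boundedCover : BoundedCover s d (contractEdge G u v)
  boundedCover = record
    { index = index′ ; index-injective = index′-injective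
    ; independent = index′-independent ; degree = index′-degree }

BoundedCover-step : ∀ {s d X Y} → X ⟶ Y → BoundedCover s d (proj₂ X) → BoundedCover s d (proj₂ Y)
BoundedCover-step (delE G u v)     = BoundedCover-subgraph (λ x → x) (λ e → e) proj₁
BoundedCover-step (delV G v)       = BoundedCover-subgraph (punchIn v) (punchIn-injective v _ _) (λ a → a)
BoundedCover-step (con G u v _ uv) = Contraction.boundedCover uv

BoundedCover-minor : ∀ {s d X Y} → Star _⟶_ X Y → BoundedCover s d (proj₂ X) → BoundedCover s d (proj₂ Y)
BoundedCover-minor ε          C = C
BoundedCover-minor (st ◅ sts) C = BoundedCover-minor sts (BoundedCover-step st C)

BoundedCover-≅ : ∀ {m n s d} {G : Graph m} {H : Graph n} → G ≅ H → BoundedCover s d G → BoundedCover s d H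
BoundedCover-≅ {G = G} {H} G≅H = BoundedCover-subgraph from (Injection.injective (↔⇒↣ (↔-sym bij))) adj-from
  where
  open _≅_ G≅H
  open Inverse bij
  adj-from : ∀ {x y} → Adj H x y → Adj G (from x) (from y)
  adj-from {x} {y} a = Equivalence.from (adj (from x) (from y))
    (subst₂ (Adj H) (sym (strictlyInverseˡ x)) (sym (strictlyInverseˡ y)) a)

≢nothing⇒just : ∀ {A : Set} (a : Maybe A) → a ≢ nothing → ∃ λ i → a ≡ just i
≢nothing⇒just (just i) _   = i , refl
≢nothing⇒just nothing  a≢ = ⊥-elim (a≢ refl)

clique-lacks-boundedCover : ∀ {s d} → d < s → ¬ BoundedCover s d (K (suc s))
clique-lacks-boundedCover {s} d<s C with any? (λ x → Maybe.≡-dec _≟_ (index C x) nothing)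
... | yes (w , w-out) =
  <⇒≱ d<s (injective⇒≤ {f = slot-of-neighbour} (punchIn-injective w _ _ ∘ slot-injective D _ _ _ _))
  where
  D = degree C w-out
  slot-of-neighbour : Fin s → Fin _
  slot-of-neighbour k = slot D (punchIn w k) (≢-sym (punchInᵢ≢i w k))
... | no none = 1+n≰n (injective⇒≤ {f = proj₁ ∘ label} label-injective)
  where
  label : ∀ x → ∃ λ l → index C x ≡ just l
  label x = ≢nothing⇒just (index C x) (λ x-out → none (x , x-out))
  label-injective : ∀ {x y} → proj₁ (label x) ≡ proj₁ (label y) → x ≡ y
  label-injective {x} {y} same =
    index-injective C (proj₂ (label x)) (subst (λ l → index C y ≡ just l) (sym same) (proj₂ (label y)))

boundedCover⇒¬cliqueMinor : ∀ {N s d} {G : Graph N} → d < s → BoundedCover s d G → ¬ HasCliqueMinor (suc s) G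
boundedCover⇒¬cliqueMinor d<s C (_ , steps , H≅K) =
  clique-lacks-boundedCover d<s (BoundedCover-≅ H≅K (BoundedCover-minor steps C))

-- E p p decides whether part p is a clique or an independent set.
blowUp : ∀ {N} {P : Set} (part : Fin N → P) (E : P → P → Bool) → (∀ p q → E p q ≡ E q p) → Graph N
blowUp part E E-sym = record
  { Adj        = λ x y → x ≢ y × T (E (part x) (part y))
  ; adj-sym    = λ {x} {y} (x≢y , e) → ≢-sym x≢y , subst T (E-sym (part x) (part y)) e
  ; adj-irrefl = λ (x≢x , _) → x≢x refl
  }

T-not⇒¬T : ∀ {b} → T (not b) → ¬ T b
T-not⇒¬T {false} _ ()

¬T-not⇒T : ∀ {b} → ¬ T (not b) → T b
¬T-not⇒T {false} ¬t = ¬t _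
¬T-not⇒T {true}  _  = _

blowUp-selfComplementary : ∀ {N} {P : Set} {part : Fin N → P} {E E-sym}
                           (σ : Fin N ↔ Fin N) (π : P → P) →
                           (∀ x → part (Inverse.to σ x) ≡ π (part x)) →
                           (∀ {x y} → x ≢ y → E (π (part x)) (π (part y)) ≡ not (E (part x) (part y))) →
                           SelfComplementary (blowUp part E E-sym)
blowUp-selfComplementary {part = part} {E} {E-sym} σ π part-σ flips = record
  { bij = σ
  ; adj = λ x y → mk⇔ (forth x y) (back x y) }
  where
  open Inverse σ
  G = blowUp part E E-sym
  E-σ : ∀ {x y} → x ≢ y → E (part (to x)) (part (to y)) ≡ not (E (part x) (part y))
  E-σ {x} {y} x≢y = trans (cong₂ E (part-σ x) (part-σ y)) (flips x≢y)
  forth : ∀ x y → Adj G x y → Adj (complement G) (to x) (to y)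
  forth x y (x≢y , e) = x≢y ∘ Injection.injective (↔⇒↣ σ) , λ (_ , e′) → T-not⇒¬T (subst T (E-σ x≢y) e′) e
  back : ∀ x y → Adj (complement G) (to x) (to y) → Adj G x y
  back x y (σx≢σy , ¬e) = x≢y , ¬T-not⇒T (λ e′ → ¬e (σx≢σy , subst T (sym (E-σ x≢y)) e′))
    where
    x≢y : x ≢ y
    x≢y = σx≢σy ∘ cong to

blocks : ∀ b n k → Fin (b * n + k) ↔ ((Fin b × Fin n) ⊎ Fin k)
blocks b n k = ↔-trans +↔⊎ (*↔× ⊎-↔ ↔-refl)

pattern b₀ = zero
pattern b₁ = suc zero
pattern b₂ = suc (suc zero)
pattern b₃ = suc (suc (suc zero))

pattern centre  = zero
pattern block b = suc b

link : Fin 5 → Fin 5 → Bool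
link (block b₀) (block b₁) = true
link (block b₁) (block b₁) = true
link (block b₁) (block b₂) = true
link (block b₂) (block b₂) = true
link (block b₂) (block b₃) = true
link (block b₁) centre     = true
link (block b₂) centre     = true
link _          _          = false

pathPattern : Fin 5 → Fin 5 → Bool
pathPattern p q = link p q ∨ link q p

pathPattern-sym : ∀ p q → pathPattern p q ≡ pathPattern q p
pathPattern-sym p q = ∨-comm (link p q) (link q p)

rotation : Fin 4 ↔ Fin 4
rotation = mk↔ₛ′ forward backward
  (λ { b₀ → refl ; b₁ → refl ; b₂ → refl ; b₃ → refl })
  (λ { b₀ → refl ; b₁ → refl ; b₂ → refl ; b₃ → refl })
  where
  forward backward : Fin 4 → Fin 4
  forward  b₀ = b₁
  forward  b₁ = b₃
  forward  b₂ = b₀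
  forward  b₃ = b₂
  backward b₀ = b₂
  backward b₁ = b₀
  backward b₂ = b₃
  backward b₃ = b₁

rotatePart : Fin 5 → Fin 5
rotatePart centre    = centre
rotatePart (block b) = block (Inverse.to rotation b)

pathPattern-rotate : ∀ p q → (p ≡ centre × q ≡ centre)
                           ⊎ pathPattern (rotatePart p) (rotatePart q) ≡ not (pathPattern p q)
pathPattern-rotate = from-yes (all? λ p → all? λ q →
  (p ≟ centre ×-dec q ≟ centre) ⊎-dec (pathPattern (rotatePart p) (rotatePart q) ≟ᵇ not (pathPattern p q)))

module BlownUpPath (n k : ℕ) where

  V : Set
  V = (Fin 4 × Fin n) ⊎ Fin k

  vertices : Fin (4 * n + k) ↔ V
  vertices = blocks 4 n k

  open Inverse vertices using (to; strictlyInverseˡ)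

  to-injective : ∀ {x y} → to x ≡ to y → x ≡ y
  to-injective = Injection.injective (↔⇒↣ vertices)

  partOf : V → Fin 5
  partOf (inj₁ (b , _)) = block b
  partOf (inj₂ _)       = centre

  part : Fin (4 * n + k) → Fin 5
  part = partOf ∘ to

  graph : Graph (4 * n + k)
  graph = blowUp part pathPattern pathPattern-sym

  centre-unique : Irrelevant (Fin k) → ∀ {x y} → part x ≡ centre → part y ≡ centre → x ≡ y
  centre-unique one {x} {y} x≡c y≡c = to-injective (unique (to x) (to y) x≡c y≡c)
    where
    unique : ∀ v w → partOf v ≡ centre → partOf w ≡ centre → v ≡ w
    unique (inj₂ i) (inj₂ j) _  _  = cong inj₂ (one i j)
    unique (inj₁ _) _        () _
    unique (inj₂ _) (inj₁ _) _  ()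

  rotateV : V ↔ V
  rotateV = (rotation ×-↔ ↔-refl) ⊎-↔ ↔-refl

  partOf-rotateV : ∀ v → partOf (Inverse.to rotateV v) ≡ rotatePart (partOf v)
  partOf-rotateV (inj₁ _) = refl
  partOf-rotateV (inj₂ _) = refl

  rotateBlocks : Fin (4 * n + k) ↔ Fin (4 * n + k)
  rotateBlocks = ↔-trans vertices (↔-trans rotateV (↔-sym vertices))

  part-rotateBlocks : ∀ x → part (Inverse.to rotateBlocks x) ≡ rotatePart (part x)
  part-rotateBlocks x = trans (cong partOf (strictlyInverseˡ _)) (partOf-rotateV (to x))

  graph-selfComplementary : Irrelevant (Fin k) → SelfComplementary graph
  graph-selfComplementary one =
    blowUp-selfComplementary {part = part} {E-sym = pathPattern-sym}
      rotateBlocks rotatePart part-rotateBlocks flips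
    where
    flips : ∀ {x y} → x ≢ y →
            pathPattern (rotatePart (part x)) (rotatePart (part y)) ≡ not (pathPattern (part x) (part y))
    flips {x} {y} x≢y with pathPattern-rotate (part x) (part y)
    ... | inj₁ (x≡c , y≡c) = ⊥-elim (x≢y (centre-unique one x≡c y≡c))
    ... | inj₂ flipped     = flipped

  labels : Fin (2 * n + k) ↔ ((Fin 2 × Fin n) ⊎ Fin k)
  labels = blocks 2 n k

  coverIndex : V → Maybe (Fin (2 * n + k))
  coverIndex (inj₁ (b₀ , _)) = nothing
  coverIndex (inj₁ (b₁ , i)) = just (Inverse.from labels (inj₁ (zero , i)))
  coverIndex (inj₁ (b₂ , i)) = just (Inverse.from labels (inj₁ (suc zero , i)))
  coverIndex (inj₁ (b₃ , _)) = nothing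
  coverIndex (inj₂ j)        = just (Inverse.from labels (inj₂ j))

  unlabel : (Fin 2 × Fin n) ⊎ Fin k → V
  unlabel (inj₁ (zero , i))     = inj₁ (b₁ , i)
  unlabel (inj₁ (suc zero , i)) = inj₁ (b₂ , i)
  unlabel (inj₂ j)              = inj₂ j

  unlabel-coverIndex : ∀ v {l} → coverIndex v ≡ just l → unlabel (Inverse.to labels l) ≡ v
  unlabel-coverIndex (inj₁ (b₁ , i)) refl = cong unlabel (Inverse.strictlyInverseˡ labels (inj₁ (zero , i)))
  unlabel-coverIndex (inj₁ (b₂ , i)) refl = cong unlabel (Inverse.strictlyInverseˡ labels (inj₁ (suc zero , i)))
  unlabel-coverIndex (inj₂ j)        refl = cong unlabel (Inverse.strictlyInverseˡ labels (inj₂ j))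
  unlabel-coverIndex (inj₁ (b₀ , _)) ()
  unlabel-coverIndex (inj₁ (b₃ , _)) ()

  outer-independent : ∀ v w → coverIndex v ≡ nothing → coverIndex w ≡ nothing →
                      ¬ T (pathPattern (partOf v) (partOf w))
  outer-independent (inj₁ (b₁ , _)) _ () _
  outer-independent (inj₁ (b₂ , _)) _ () _
  outer-independent (inj₂ _)        _ () _
  outer-independent _ (inj₁ (b₁ , _)) _ ()
  outer-independent _ (inj₁ (b₂ , _)) _ ()
  outer-independent _ (inj₂ _)        _ ()
  outer-independent (inj₁ (b₀ , _)) (inj₁ (b₀ , _)) _ _ ()
  outer-independent (inj₁ (b₀ , _)) (inj₁ (b₃ , _)) _ _ ()
  outer-independent (inj₁ (b₃ , _)) (inj₁ (b₀ , _)) _ _ ()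
  outer-independent (inj₁ (b₃ , _)) (inj₁ (b₃ , _)) _ _ ()

  outer-neighbours : ∀ w → coverIndex w ≡ nothing → ∃ λ β →
                     ∀ v → T (pathPattern (partOf w) (partOf v)) → ∃ λ j → v ≡ inj₁ (β , j)
  outer-neighbours (inj₁ (b₀ , _)) _ = b₁ , λ
    { (inj₁ (b₁ , j)) _ → j , refl
    ; (inj₁ (b₀ , _)) () ; (inj₁ (b₂ , _)) () ; (inj₁ (b₃ , _)) () ; (inj₂ _) () }
  outer-neighbours (inj₁ (b₃ , _)) _ = b₂ , λ
    { (inj₁ (b₂ , j)) _ → j , refl
    ; (inj₁ (b₀ , _)) () ; (inj₁ (b₁ , _)) () ; (inj₁ (b₃ , _)) () ; (inj₂ _) () }
  outer-neighbours (inj₁ (b₁ , _)) ()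
  outer-neighbours (inj₁ (b₂ , _)) ()
  outer-neighbours (inj₂ _)        ()

  outer-degree : ∀ {w} → coverIndex (to w) ≡ nothing → DegreeAtMost n graph w
  outer-degree {w} w-out with β , nbr ← outer-neighbours (to w) w-out = record
    { slot           = λ x a → proj₁ (nbr (to x) (proj₂ a))
    ; slot-injective = λ x y a b same → to-injective (begin
        to x                             ≡⟨ proj₂ (nbr (to x) (proj₂ a)) ⟩
        inj₁ (β , proj₁ (nbr _ (proj₂ a))) ≡⟨ cong (λ j → inj₁ (β , j)) same ⟩
        inj₁ (β , proj₁ (nbr _ (proj₂ b))) ≡⟨ proj₂ (nbr (to y) (proj₂ b)) ⟨
        to y                             ∎)
    }
    where open ≡-Reasoning

  graph-boundedCover : BoundedCover (2 * n + k) n graph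
  graph-boundedCover = record
    { index           = coverIndex ∘ to
    ; index-injective = λ {x} {y} x≡l y≡l →
        to-injective (trans (sym (unlabel-coverIndex (to x) x≡l)) (unlabel-coverIndex (to y) y≡l))
    ; independent     = λ {x} {y} x-out y-out (_ , e) → outer-independent (to x) (to y) x-out y-out e
    ; degree          = outer-degree
    }

  graph-noCliqueMinor : n < 2 * n + k → ¬ HasCliqueMinor (suc (2 * n + k)) graph
  graph-noCliqueMinor n<s = boundedCover⇒¬cliqueMinor n<s graph-boundedCover

n<2n+k : ∀ n k → 1 ≤ n + k → n < 2 * n + k
n<2n+k n k 1≤n+k = subst (n <_) (sym 2n+k≡n+[n+k]) (m<m+n n 1≤n+k)
  where
  2n+k≡n+[n+k] : 2 * n + k ≡ n + (n + k)
  2n+k≡n+[n+k] = trans (+-assoc n (n + 0) k) (cong (λ m → n + (m + k)) (+-identityʳ n))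

SelfComplementaryWithoutCliqueMinor : ℕ → ℕ → Set₁
SelfComplementaryWithoutCliqueMinor N m = Σ (Graph N) λ G → SelfComplementary G × ¬ HasCliqueMinor m G

blownUpPath : ∀ n k → Irrelevant (Fin k) → 1 ≤ n + k →
              SelfComplementaryWithoutCliqueMinor (4 * n + k) (suc (2 * n + k))
blownUpPath n k one 1≤n+k = graph , graph-selfComplementary one , graph-noCliqueMinor (n<2n+k n k 1≤n+k)
  where open BlownUpPath n k

mainTheorem6 : ((n : ℕ) → 1 ≤ n →
                 Σ (Graph (4 * n)) λ G → SelfComplementary G × ¬ HasCliqueMinor (2 * n + 1) G)
               × ((n : ℕ) →
                 Σ (Graph (4 * n + 1)) λ G → SelfComplementary G × ¬ HasCliqueMinor (2 * n + 2) G)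
mainTheorem6 = order4n , order4n+1
  where
  order4n : ∀ n → 1 ≤ n → SelfComplementaryWithoutCliqueMinor (4 * n) (2 * n + 1)
  order4n n 1≤n = subst₂ SelfComplementaryWithoutCliqueMinor (+-identityʳ (4 * n))
    (trans (cong suc (+-identityʳ (2 * n))) (+-comm 1 (2 * n)))
    (blownUpPath n 0 (λ ()) (≤-trans 1≤n (m≤m+n n 0)))
  order4n+1 : ∀ n → SelfComplementaryWithoutCliqueMinor (4 * n + 1) (2 * n + 2)
  order4n+1 n = subst (SelfComplementaryWithoutCliqueMinor (4 * n + 1)) (sym (+-suc (2 * n) 1))
    (blownUpPath n 1 (λ { zero zero → refl }) (m≤n+m 1 n))
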